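{- Let $\mathcal{M}_1=(V,\mathcal{I}_1),\dots,\mathcal{M}_k=(V,\mathcal{I}_k)$ be matroids on a common ground set $V$ with $|V|=n$, accessible through independence oracles, and let $p$ be the maximum cardinality of a partitionable set. There is an algorithm which, given a partition $(S_1,\dots,S_k)$ of a set $S\subseteq V$ with $S_i\in\mathcal{I}_i$ for all $i$, outputs for every vertex $v\in V\cup\{s\}\cup T$ the distance from $s$ to $v$ in the compressed exchange graph $G(S_1,\dots,S_k)$, using $O(kn+p\log p)$ independence oracle queries.
   Context: A set is partitionable if it admits a partition $(S_1,\dots,S_k)$ with $S_i\in\mathcal{I}_i$. The compressed exchange graph $G(S_1,\dots,S_k)$ is the directed graph on vertex set $V\cup\{s,t_1,\dots,t_k\}$ (new vertices $s,t_1,\dots,t_k$), $T=\{t_1,\dots,t_k\}$, with edge set $E'\cup E_s\cup E_t$ where $E'=\{(v,u): \exists i\in[k],\ u\in S_i,\ S_i+v\notin\mathcal{I}_i,\ S_i+v-u\in\mathcal{I}_i\}$, $E_s=\{(s,v): v\in V\setminus S\}$, and $E_t=\bigcup_{i=1}^k\{(v,t_i): v\in V\setminus S_i,\ S_i+v\in\mathcal{I}_i\}$. Distances are lengths of shortest directed paths ($\infty$ if unreachable). An independence oracle for $\mathcal{M}_i$ answers whether a given $X\subseteq V$ is in $\mathcal{I}_i$. -}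

module Defs where

open import Data.Nat using (ℕ; zero; suc; _+_; _*_; _≤_; _<_)
open import Data.Nat.Logarithm using (⌊log₂_⌋)
open import Data.Bool using (Bool; true; false)
open import Data.Fin using (Fin)
open import Data.Fin.Subset using (Subset; ⁅_⁆; _∈_; _∉_; _⊆_; _∪_; _─_; ∣_∣; ⊥)
open import Data.Maybe using (Maybe; just; nothing)
open import Data.Vec using (tabulate)
open import Data.Product using (Σ; Σ-syntax; ∃; ∃-syntax; _×_; _,_)
open import Relation.Nullary using (¬_)
open import Relation.Nullary.Decidable using (⌊_⌋)
open import Relation.Binary.PropositionalEquality using (_≡_)
import Data.Fin as F

-- Ground set V = Fin n.  An independence family on V is given by its
-- (Boolean) membership test, i.e. exactly what an independence oracle answers.
Indep : ℕ → Set
Indep n = Subset n → Bool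

record IsMatroid {n : ℕ} (I : Indep n) : Set where
  field
    empty-indep : I ⊥ ≡ true
    down-closed : ∀ X Y → Y ⊆ X → I X ≡ true → I Y ≡ true
    exchange    : ∀ X Y → I X ≡ true → I Y ≡ true → ∣ X ∣ < ∣ Y ∣ →
                  ∃[ v ] (v ∈ Y × v ∉ X × I (X ∪ ⁅ v ⁆) ≡ true)

-- A partition (S_1,…,S_k) of a set S ⊆ V is represented by the map sending
-- each element of S to the index of its block, and elements outside S to nothing.
Assignment : ℕ → ℕ → Set
Assignment n k = Fin n → Maybe (Fin k)

inBlock : {k : ℕ} → Fin k → Maybe (Fin k) → Bool
inBlock i nothing  = false
inBlock i (just j) = ⌊ i F.≟ j ⌋

isJust : {k : ℕ} → Maybe (Fin k) → Bool
isJust nothing  = false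
isJust (just _) = true

block : {n k : ℕ} → Assignment n k → Fin k → Subset n
block f i = tabulate (λ v → inBlock i (f v))

covered : {n k : ℕ} → Assignment n k → Subset n
covered f = tabulate (λ v → isJust (f v))

ValidPartition : {n k : ℕ} → (Fin k → Indep n) → Assignment n k → Set
ValidPartition M f = ∀ i → M i (block f i) ≡ true

Partitionable : {n k : ℕ} → (Fin k → Indep n) → Subset n → Set
Partitionable M X = Σ[ f ∈ Assignment _ _ ] (ValidPartition M f × covered f ≡ X)

IsMaxPartitionable : {n k : ℕ} → (Fin k → Indep n) → ℕ → Set
IsMaxPartitionable M p =
  (Σ[ X ∈ Subset _ ] (Partitionable M X × ∣ X ∣ ≡ p)) ×
  (∀ X → Partitionable M X → ∣ X ∣ ≤ p)

data Vtx (n k : ℕ) : Set where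
  vx  : Fin n → Vtx n k
  src : Vtx n k
  tgt : Fin k → Vtx n k

data Edge {n k : ℕ} (M : Fin k → Indep n) (f : Assignment n k) : Vtx n k → Vtx n k → Set where
  exch : ∀ (v u : Fin n) (i : Fin k) → u ∈ block f i →
         M i (block f i ∪ ⁅ v ⁆) ≡ false →
         M i ((block f i ∪ ⁅ v ⁆) ─ ⁅ u ⁆) ≡ true →
         Edge M f (vx v) (vx u)
  fromS : ∀ (v : Fin n) → v ∉ covered f → Edge M f src (vx v)
  toT   : ∀ (v : Fin n) (i : Fin k) → v ∉ block f i →
          M i (block f i ∪ ⁅ v ⁆) ≡ true → Edge M f (vx v) (tgt i)

data WalkFromS {n k : ℕ} (M : Fin k → Indep n) (f : Assignment n k) : Vtx n k → ℕ → Set where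
  here : WalkFromS M f src 0
  step : ∀ {u v d} → WalkFromS M f u d → Edge M f u v → WalkFromS M f v (suc d)

-- d = dist(s,v); nothing encodes ∞
IsDist : {n k : ℕ} (M : Fin k → Indep n) (f : Assignment n k) → Vtx n k → Maybe ℕ → Set
IsDist M f v (just d) = WalkFromS M f v d × (∀ d' → WalkFromS M f v d' → d ≤ d')
IsDist M f v nothing  = ∀ d → ¬ WalkFromS M f v d

-- Oracle algorithms: decision trees whose internal nodes ask
-- "is X ∈ I_i ?" and whose leaves hold the output.
data Query (n k : ℕ) (A : Set) : Set where
  ret : A → Query n k A
  ask : Fin k → Subset n → (Bool → Query n k A) → Query n k A

run : {n k : ℕ} {A : Set} → (Fin k → Indep n) → Query n k A → A
run M (ret a)       = a
run M (ask i X c)   = run M (c (M i X))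

cost : {n k : ℕ} {A : Set} → (Fin k → Indep n) → Query n k A → ℕ
cost M (ret a)     = 0
cost M (ask i X c) = suc (cost M (c (M i X)))

DistAlgorithm : Set
DistAlgorithm = (n k : ℕ) → Assignment n k → Query n k (Vtx n k → Maybe ℕ)

-- The algorithm first asks whether S_i + x ∈ I_i for all i and x (k n queries); these answers give
-- the edges into T and the blocks i for which v has exchange edges into S_i, namely those with
-- S_i + v dependent. For such a block, S_i + v contains a unique circuit C, the out-neighbours of v
-- in S_i are the elements of C − v, and for W ⊆ S_i the set S_i + v − W is independent exactly
-- when W meets C. Breadth-first search from s therefore finds the unlabelled out-neighbours of v
-- in S_i by adaptive group testing on the unlabelled part of S_i: test W, and split it in halves
-- only if the test is positive. A split always uncovers a new vertex, so a search of depth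
-- h = 1 + ⌊log₂ ∣ S ∣⌋ that labels m vertices makes at most 1 + 2 h m queries. Each vertex of S is
-- labelled once, which gives O(k n + ∣ S ∣ log ∣ S ∣) queries with ∣ S ∣ ≤ p. The labels are
-- correct because every label is the length of a walk from s and no edge raises the label by more
-- than one.
module Submission where

open import Defs
open import Data.Bool using (Bool; true; false; if_then_else_; T; not; _∧_)
open import Data.Bool.Properties using (T-≡; T?)
open import Data.Fin using (Fin; zero; suc)
import Data.Fin.Properties as Fin
open import Data.Fin.Subset using (Subset; ⁅_⁆; _∈_; _∉_; _⊆_; _∪_; _─_; _-_; ∣_∣; ⊥)
open import Data.Fin.Subset.Properties
  using (_∈?_; ∉⊥; x∈⁅x⁆; x∈⁅y⁆⇒x≡y; x∈p∪q⁺; x∈p∪q⁻; p⊆p∪q; ∪-identityʳ; p─q⊆p; x∈p∧x∉q⇒x∈p─q;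
         x∈p∧x≢y⇒x∈p-y; ⊆-antisym; ∣⊥∣≡0; ∣p∣≤n; p⊆q⇒∣p∣≤∣q∣; p⊂q⇒∣p∣<∣q∣; x∈p⇒∣p-x∣<∣p∣)
open import Data.List using (List; []; _∷_; _++_; length; take; drop; filterᵇ; allFin; foldr; mapMaybe)
open import Data.List.Extrema.Nat using (min; min≤v⁺; argmin-all)
open import Data.List.Membership.Propositional using () renaming (_∈_ to _∈ˡ_)
import Data.List.Membership.Propositional.Properties as ∈ˡ
open ∈ˡ using (∈-++⁺ˡ; ∈-++⁺ʳ; ∈-++⁻)
open import Data.List.Properties
  using (length-tabulate; length-++; length-take; length-drop; take++drop≡id; filter-++; filter-none; filter-some)
import Data.List.Relation.Unary.All as All
open All using (All; []; _∷_)
import Data.List.Relation.Unary.All.Properties as Allₚ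
import Data.List.Relation.Unary.AllPairs as AllPairs
import Data.List.Relation.Unary.Any as Any
open Any using (Any; here; there)
import Data.List.Relation.Unary.Any.Properties as Anyₚ
open import Data.List.Relation.Unary.Unique.Propositional using (Unique)
import Data.List.Relation.Unary.Unique.Propositional.Properties as Unique
open import Data.Maybe using (Maybe; just; nothing; is-nothing)
import Data.Maybe as Maybe
open import Data.Maybe.Properties using (just-injective)
import Data.Maybe.Relation.Unary.All as MaybeAll
import Data.Maybe.Relation.Unary.Any as MaybeAny
open import Data.Nat using (ℕ; zero; suc; _+_; _*_; _^_; _≤_; _<_; z≤n; s≤s; _≤?_)
open import Data.Nat.Logarithm using (⌊log₂_⌋; ⌊log₂⌋-mono-≤; ⌊log₂[2^n]⌋≡n)
open import Data.Nat.Properties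
open import Data.Nat.Tactic.RingSolver using (solve-∀)
open import Data.Product using (Σ-syntax; ∃-syntax; _×_; _,_; proj₁; proj₂)
open import Data.Sum using (_⊎_; inj₁; inj₂; [_,_]′)
import Data.Sum as Sum
open import Data.Vec using (_∷_; here; there)
import Data.Vec as Vec
import Data.Vec.Functional as Vector
open import Data.Vec.Properties using (lookup⇒[]=; []=⇒lookup; lookup∘tabulate)
open import Function using (_∘_; _$_; id; flip)
open import Function.Bundles using (Equivalence)
open import Relation.Binary.PropositionalEquality
open import Relation.Nullary using (¬_; Dec; contradiction; yes; no)
open import Relation.Nullary.Decidable using (_→-dec_)

private
  variable
    n k : ℕ
    A B S : Set

≡true⇒T : ∀ {b} → b ≡ true → T b
≡true⇒T = Equivalence.from T-≡

T⇒≡true : ∀ {b} → T b → b ≡ true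
T⇒≡true = Equivalence.to T-≡

∈-filterᵇ⁺ : ∀ {p : A → Bool} {x xs} → x ∈ˡ xs → p x ≡ true → x ∈ˡ filterᵇ p xs
∈-filterᵇ⁺ {p = p} x∈ px = ∈ˡ.∈-filter⁺ (T? ∘ p) x∈ (≡true⇒T px)

∈-filterᵇ⁻ : ∀ (p : A → Bool) xs {x} → x ∈ˡ filterᵇ p xs → x ∈ˡ xs × p x ≡ true
∈-filterᵇ⁻ p xs x∈ with ∈ˡ.∈-filter⁻ (T? ∘ p) x∈
... | x∈xs , px = x∈xs , T⇒≡true px

length-take-drop≤ : ∀ m (xs : List A) → length xs ≤ m + m →
                    length (take m xs) ≤ m × length (drop m xs) ≤ m
length-take-drop≤ m xs len =
  subst (_≤ m) (sym (length-take m xs)) (m⊓n≤m m (length xs)) ,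
  subst (_≤ m) (sym (length-drop m xs)) (m≤n+o⇒m∸n≤o (length xs) m len)

2^suc≡2^+2^ : ∀ h → 2 ^ suc h ≡ 2 ^ h + 2 ^ h
2^suc≡2^+2^ h = cong (2 ^ h +_) (+-identityʳ (2 ^ h))

is-nothing⇒≡nothing : ∀ {m : Maybe A} → is-nothing m ≡ true → m ≡ nothing
is-nothing⇒≡nothing {m = nothing} _ = refl

n<2^suc⌊log₂n⌋ : ∀ n → n < 2 ^ suc ⌊log₂ n ⌋
n<2^suc⌊log₂n⌋ n = ≰⇒> λ 2^≤n → n≮n ⌊log₂ n ⌋
  (subst (_≤ ⌊log₂ n ⌋) (⌊log₂[2^n]⌋≡n (suc ⌊log₂ n ⌋)) (⌊log₂⌋-mono-≤ 2^≤n))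

n≤n*⌊log₂n⌋+1 : ∀ n → n ≤ n * ⌊log₂ n ⌋ + 1
n≤n*⌊log₂n⌋+1 zero            = z≤n
n≤n*⌊log₂n⌋+1 (suc zero)      = m≤n+m 1 (1 * ⌊log₂ 1 ⌋)
n≤n*⌊log₂n⌋+1 n@(suc (suc _)) = begin
  n                  ≡⟨ *-identityʳ n ⟨
  n * 1              ≤⟨ *-monoʳ-≤ n 1≤⌊log₂n⌋ ⟩
  n * ⌊log₂ n ⌋      ≤⟨ m≤m+n _ 1 ⟩
  n * ⌊log₂ n ⌋ + 1  ∎
  where
  open ≤-Reasoning
  1≤⌊log₂n⌋ : 1 ≤ ⌊log₂ n ⌋
  1≤⌊log₂n⌋ = subst (_≤ ⌊log₂ n ⌋) (⌊log₂[2^n]⌋≡n 1) (⌊log₂⌋-mono-≤ {2 ^ 1} {n} (s≤s (s≤s z≤n)))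

minimumᴹ : List ℕ → Maybe ℕ
minimumᴹ []       = nothing
minimumᴹ (a ∷ as) = just (min a as)

minimumᴹ-just : ∀ {P : ℕ → Set} {as b} → All P as → minimumᴹ as ≡ just b → P b
minimumᴹ-just {P = P} (pa ∷ pas) refl = argmin-all id {P = P} pa pas

minimumᴹ-≤ : ∀ {as c} → Any (_≤ c) as → ∃[ b ] (minimumᴹ as ≡ just b × b ≤ c)
minimumᴹ-≤ {a ∷ as} (here a≤c)  = min a as , refl , min≤v⁺ a as (inj₁ a≤c)
minimumᴹ-≤ {a ∷ as} (there ≤c) = min a as , refl , min≤v⁺ a as (inj₂ ≤c)

fromList : List (Fin n) → Subset n
fromList = foldr (λ x p → ⁅ x ⁆ ∪ p) ⊥

∈-fromList⁺ : ∀ {x} {xs : List (Fin n)} → x ∈ˡ xs → x ∈ fromList xs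
∈-fromList⁺ {x = x} (here refl) = x∈p∪q⁺ (inj₁ (x∈⁅x⁆ x))
∈-fromList⁺         (there x∈)  = x∈p∪q⁺ (inj₂ (∈-fromList⁺ x∈))

∈-fromList⁻ : ∀ {x} (xs : List (Fin n)) → x ∈ fromList xs → x ∈ˡ xs
∈-fromList⁻ []       x∈ = contradiction x∈ ∉⊥
∈-fromList⁻ (y ∷ xs) x∈ with x∈p∪q⁻ ⁅ y ⁆ (fromList xs) x∈
... | inj₁ x∈⁅y⁆ = here (x∈⁅y⁆⇒x≡y y x∈⁅y⁆)
... | inj₂ x∈xs  = there (∈-fromList⁻ xs x∈xs)

∪⁅⁆⊆ : ∀ {p q : Subset n} {x} → p ⊆ q → x ∈ q → p ∪ ⁅ x ⁆ ⊆ q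
∪⁅⁆⊆ {p = p} {x = x} p⊆q x∈q y∈ with x∈p∪q⁻ p ⁅ x ⁆ y∈
... | inj₁ y∈p   = p⊆q y∈p
... | inj₂ y∈⁅x⁆ = subst (_∈ _) (sym (x∈⁅y⁆⇒x≡y x y∈⁅x⁆)) x∈q

∣p∪⁅x⁆∣≡1+∣p∣ : ∀ {x} (p : Subset n) → x ∉ p → ∣ p ∪ ⁅ x ⁆ ∣ ≡ suc ∣ p ∣
∣p∪⁅x⁆∣≡1+∣p∣ {x = zero}  (true  ∷ p) x∉p = contradiction here x∉p
∣p∪⁅x⁆∣≡1+∣p∣ {x = zero}  (false ∷ p) x∉p = cong (suc ∘ ∣_∣) (∪-identityʳ p)
∣p∪⁅x⁆∣≡1+∣p∣ {x = suc x} (true  ∷ p) x∉p = cong suc (∣p∪⁅x⁆∣≡1+∣p∣ p (x∉p ∘ there))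
∣p∪⁅x⁆∣≡1+∣p∣ {x = suc x} (false ∷ p) x∉p = ∣p∪⁅x⁆∣≡1+∣p∣ p (x∉p ∘ there)

p⊆q∧∣q∣≤∣p∣⇒q⊆p : ∀ {p q : Subset n} → p ⊆ q → ∣ q ∣ ≤ ∣ p ∣ → q ⊆ p
p⊆q∧∣q∣≤∣p∣⇒q⊆p {p = p} p⊆q ∣q∣≤∣p∣ {x} x∈q with x ∈? p
... | yes x∈p = x∈p
... | no  x∉p = contradiction ∣q∣≤∣p∣ (<⇒≱ (p⊂q⇒∣p∣<∣q∣ (p⊆q , x , x∈q , x∉p)))

p⊈q⇒∃x∈p∖q : ∀ {p q : Subset n} → ¬ (p ⊆ q) → ∃[ x ] (x ∈ p × x ∉ q)
p⊈q⇒∃x∈p∖q {n} {p} {q} p⊈q with Fin.¬∀⟶∃¬ n (λ x → x ∈ p → x ∈ q) (λ x → x ∈? p →-dec x ∈? q) (λ all → p⊈q (all _))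
... | x , ¬[x∈p⇒x∈q] with x ∈? p
...   | yes x∈p = x , x∈p , ¬[x∈p⇒x∈q] ∘ λ x∈q _ → x∈q
...   | no  x∉p = contradiction (λ x∈p → contradiction x∈p x∉p) ¬[x∈p⇒x∈q]

length+∣q∣≤∣p∣ : ∀ {xs : List (Fin n)} {p q} → Unique xs → All (_∈ p) xs → All (_∉ q) xs → q ⊆ p →
                 length xs + ∣ q ∣ ≤ ∣ p ∣
length+∣q∣≤∣p∣ AllPairs.[]         []             []             q⊆p = p⊆q⇒∣p∣≤∣q∣ q⊆p
length+∣q∣≤∣p∣ {p = p} {q} (x≢xs AllPairs.∷ unique) (x∈p ∷ xs∈p) (x∉q ∷ xs∉q) q⊆p =
  <-≤-trans (s≤s (length+∣q∣≤∣p∣ unique xs∈p-x xs∉q q⊆p-x)) (x∈p⇒∣p-x∣<∣p∣ x∈p)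
  where
  xs∈p-x : All (_∈ p - _) _
  xs∈p-x = All.zipWith (λ (x≢y , y∈p) → x∈p∧x≢y⇒x∈p-y y∈p (x≢y ∘ sym)) (x≢xs , xs∈p)
  q⊆p-x : q ⊆ p - _
  q⊆p-x y∈q = x∈p∧x≢y⇒x∈p-y (q⊆p y∈q) λ { refl → x∉q y∈q }

length≤∣p∣ : ∀ {xs : List (Fin n)} {p} → Unique xs → All (_∈ p) xs → length xs ≤ ∣ p ∣
length≤∣p∣ {n} {xs} {p} unique xs∈p = begin
  length xs                ≡⟨ +-identityʳ _ ⟨
  length xs + 0            ≡⟨ cong (length xs +_) (∣⊥∣≡0 n) ⟨
  length xs + ∣ ⊥ {n} ∣     ≤⟨ length+∣q∣≤∣p∣ unique xs∈p (All.universal (λ _ → ∉⊥) xs) (flip contradiction ∉⊥) ⟩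
  ∣ p ∣                    ∎
  where open ≤-Reasoning

x∈p─q⇒x∉q : ∀ {x} (p q : Subset n) → x ∈ p ─ q → x ∉ q
x∈p─q⇒x∉q (s ∷ p) (true ∷ q) ()        here
x∈p─q⇒x∉q (s ∷ p) (t    ∷ q) (there x∈) (there x∈q) = x∈p─q⇒x∉q p q x∈ x∈q

p─q⊆p-x : ∀ {x} (p q : Subset n) → x ∈ q → p ─ q ⊆ p - x
p─q⊆p-x p q x∈q y∈ = x∈p∧x≢y⇒x∈p-y (p─q⊆p p q y∈) λ { refl → x∈p─q⇒x∉q p q y∈ x∈q }

∈-tabulate⁺ : ∀ {g : Fin n → Bool} {x} → g x ≡ true → x ∈ Vec.tabulate g
∈-tabulate⁺ {g = g} {x} gx = lookup⇒[]= x (Vec.tabulate g) (trans (lookup∘tabulate g x) gx)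

∈-tabulate⁻ : ∀ {g : Fin n → Bool} {x} → x ∈ Vec.tabulate g → g x ≡ true
∈-tabulate⁻ {g = g} {x} x∈ = trans (sym (lookup∘tabulate g x)) ([]=⇒lookup x∈)

-- Matroids
module _ {I : Indep n} (matroid : IsMatroid I) where
  open IsMatroid matroid

  augment-within : ∀ m {A S} X → X ⊆ A → S ⊆ A → I X ≡ true → I S ≡ true → ∣ S ∣ ≤ m + ∣ X ∣ →
                   ∃[ Z ] (X ⊆ Z × Z ⊆ A × I Z ≡ true × ∣ S ∣ ≤ ∣ Z ∣)
  augment-within m {S = S} X X⊆A S⊆A iX iS le with ∣ S ∣ ≤? ∣ X ∣
  ... | yes S≤X = X , id , X⊆A , iX , S≤X
  augment-within zero    X X⊆A S⊆A iX iS le | no S≰X = contradiction le S≰X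
  augment-within (suc m) {S = S} X X⊆A S⊆A iX iS le | no S≰X with exchange X S iX iS (≰⇒> S≰X)
  ... | w , w∈S , w∉X , iX+w
    with augment-within m (X ∪ ⁅ w ⁆) (∪⁅⁆⊆ X⊆A (S⊆A w∈S)) S⊆A iX+w iS
           (subst (∣ S ∣ ≤_) (sym (trans (cong (m +_) (∣p∪⁅x⁆∣≡1+∣p∣ X w∉X)) (+-suc m ∣ X ∣))) le)
  ... | Z , X+w⊆Z , grown = Z , X+w⊆Z ∘ p⊆p∪q ⁅ w ⁆ , grown

  module _ {S v} (iS : I S ≡ true) (v∉S : v ∉ S) (dep : I (S ∪ ⁅ v ⁆) ≡ false) where

    private
      S+v = S ∪ ⁅ v ⁆

      independent⊈S+v : ∀ {Z} → I Z ≡ true → Z ⊆ S+v → ¬ (S+v ⊆ Z)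
      independent⊈S+v iZ Z⊆S+v S+v⊆Z =
        contradiction (trans (sym iZ) (trans (cong I (⊆-antisym Z⊆S+v S+v⊆Z)) dep)) λ ()

    -- Augment S + v − W inside S + v to an independent Z with ∣ S ∣ ≤ ∣ Z ∣. As S + v is dependent,
    -- Z = S + v − u for an element u missing from Z, and u ∈ W because S + v − W ⊆ Z.
    independent-removal : ∀ W → I ((S ∪ ⁅ v ⁆) ─ W) ≡ true →
                          ∃[ u ] (u ∈ W × I ((S ∪ ⁅ v ⁆) - u) ≡ true)
    independent-removal W iS+v─W
      with augment-within ∣ S ∣ (S+v ─ W) (p─q⊆p S+v W) (p⊆p∪q ⁅ v ⁆) iS+v─W iS (m≤m+n ∣ S ∣ _)
    ... | Z , S+v─W⊆Z , Z⊆S+v , iZ , ∣S∣≤∣Z∣ with p⊈q⇒∃x∈p∖q (independent⊈S+v iZ Z⊆S+v)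
    ... | u , u∈S+v , u∉Z = u , u∈W , down-closed Z (S+v - u) S+v-u⊆Z iZ
      where
      Z⊆S+v-u : Z ⊆ S+v - u
      Z⊆S+v-u x∈Z = x∈p∧x≢y⇒x∈p-y (Z⊆S+v x∈Z) λ { refl → u∉Z x∈Z }
      ∣S+v-u∣≤∣S∣ : ∣ S+v - u ∣ ≤ ∣ S ∣
      ∣S+v-u∣≤∣S∣ = ≤-pred (subst (∣ S+v - u ∣ <_) (∣p∪⁅x⁆∣≡1+∣p∣ S v∉S) (x∈p⇒∣p-x∣<∣p∣ u∈S+v))
      S+v-u⊆Z : S+v - u ⊆ Z
      S+v-u⊆Z = p⊆q∧∣q∣≤∣p∣⇒q⊆p Z⊆S+v-u (≤-trans ∣S+v-u∣≤∣S∣ ∣S∣≤∣Z∣)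
      u∈W : u ∈ W
      u∈W with u ∈? W
      ... | yes u∈W = u∈W
      ... | no  u∉W = contradiction (S+v─W⊆Z (x∈p∧x∉q⇒x∈p─q u∈S+v u∉W)) u∉Z

infixl 1 _>>=_
_>>=_ : Query n k A → (A → Query n k B) → Query n k B
ret a     >>= g = g a
ask i X c >>= g = ask i X (λ b → c b >>= g)

foldQ : (A → S → Query n k S) → List A → S → Query n k S
foldQ act []       σ = ret σ
foldQ act (a ∷ as) σ = act a σ >>= foldQ act as

tabulateQ : ∀ {m} → (Fin m → Query n k A) → Query n k (Fin m → A)
tabulateQ {m = zero}  g = ret Vector.[]
tabulateQ {m = suc m} g = g zero >>= λ a → tabulateQ (g ∘ suc) >>= λ h → ret (a Vector.∷ h)

amortised-+ : ∀ {c₁ c₂ x₁ x₂ Φ₀ Φ₁ Φ₂} → x₁ + Φ₁ ≤ c₁ + Φ₀ → x₂ + Φ₂ ≤ c₂ + Φ₁ →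
              (x₁ + x₂) + Φ₂ ≤ (c₁ + c₂) + Φ₀
amortised-+ {c₁} {c₂} {x₁} {x₂} {Φ₀} {Φ₁} {Φ₂} h₁ h₂ = +-cancelʳ-≤ Φ₁ _ _ $ begin
  x₁ + x₂ + Φ₂ + Φ₁     ≡⟨ shuffle x₁ x₂ Φ₂ Φ₁ ⟩
  (x₁ + Φ₁) + (x₂ + Φ₂) ≤⟨ +-mono-≤ h₁ h₂ ⟩
  (c₁ + Φ₀) + (c₂ + Φ₁) ≡⟨ regroup c₁ Φ₀ c₂ Φ₁ ⟩
  c₁ + c₂ + Φ₀ + Φ₁     ∎
  where
  open ≤-Reasoning
  shuffle : ∀ a b c d → a + b + c + d ≡ (a + d) + (b + c)
  shuffle = solve-∀
  regroup : ∀ a b c d → (a + b) + (c + d) ≡ a + c + b + d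
  regroup = solve-∀

module _ (M : Fin k → Indep n) where

  run->>= : (q : Query n k A) (g : A → Query n k B) → run M (q >>= g) ≡ run M (g (run M q))
  run->>= (ret a)     g = refl
  run->>= (ask i X c) g = run->>= (c (M i X)) g

  cost->>= : (q : Query n k A) (g : A → Query n k B) →
             cost M (q >>= g) ≡ cost M q + cost M (g (run M q))
  cost->>= (ret a)     g = refl
  cost->>= (ask i X c) g = cong suc (cost->>= (c (M i X)) g)

  run-tabulateQ : ∀ {m} (g : Fin m → Query n k A) j → run M (tabulateQ g) j ≡ run M (g j)
  run-tabulateQ {m = suc m} g j
    rewrite run->>= (g zero) (λ a → tabulateQ (g ∘ suc) >>= λ h → ret (a Vector.∷ h))
          | run->>= (tabulateQ (g ∘ suc)) (λ h → ret (run M (g zero) Vector.∷ h))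
    with j
  ... | zero  = refl
  ... | suc j = run-tabulateQ (g ∘ suc) j

  cost-tabulateQ : ∀ {m c} (g : Fin m → Query n k A) → (∀ j → cost M (g j) ≤ c) →
                   cost M (tabulateQ g) ≤ m * c
  cost-tabulateQ {m = zero}  g bound = z≤n
  cost-tabulateQ {m = suc m} g bound
    rewrite cost->>= (g zero) (λ a → tabulateQ (g ∘ suc) >>= λ h → ret (a Vector.∷ h))
          | cost->>= (tabulateQ (g ∘ suc)) (λ h → ret (run M (g zero) Vector.∷ h))
          | +-identityʳ (cost M (tabulateQ (g ∘ suc)))
    = +-mono-≤ (bound zero) (cost-tabulateQ (g ∘ suc) (bound ∘ suc))

  module _ (act : A → S → Query n k S) where

    foldQ-invariant : (P : List A → S → Set) →
                      (∀ {a as σ} → P (a ∷ as) σ → P as (run M (act a σ))) →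
                      ∀ as {σ} → P as σ → P [] (run M (foldQ act as σ))
    foldQ-invariant P preserve []       p = p
    foldQ-invariant P preserve (a ∷ as) {σ} p
      rewrite run->>= (act a σ) (foldQ act as) = foldQ-invariant P preserve as (preserve p)

    foldQ-monotone : (_≼_ : S → S → Set) → (∀ {σ} → σ ≼ σ) →
                     (∀ {σ₁ σ₂ σ₃} → σ₁ ≼ σ₂ → σ₂ ≼ σ₃ → σ₁ ≼ σ₃) →
                     (∀ a σ → σ ≼ run M (act a σ)) → ∀ as σ → σ ≼ run M (foldQ act as σ)
    foldQ-monotone _≼_ ≼-refl ≼-trans increasing as σ =
      foldQ-invariant (λ _ σ′ → σ ≼ σ′) (λ {a} {_} {σ₁} σ≼σ₁ → ≼-trans σ≼σ₁ (increasing a σ₁)) as ≼-refl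

    foldQ-cost : (Φ : S → ℕ) (c : ℕ) →
                 (∀ a σ → cost M (act a σ) + Φ (run M (act a σ)) ≤ c + Φ σ) →
                 ∀ as σ → cost M (foldQ act as σ) + Φ (run M (foldQ act as σ)) ≤ length as * c + Φ σ
    foldQ-cost Φ c amortised []       σ = ≤-refl
    foldQ-cost Φ c amortised (a ∷ as) σ
      rewrite cost->>= (act a σ) (foldQ act as) | run->>= (act a σ) (foldQ act as)
      = amortised-+ {c₁ = c} {c₂ = length as * c} (amortised a σ) (foldQ-cost Φ c amortised as (run M (act a σ)))

-- Adaptive group testing
splitting-cost : ∀ {c₁ c₂ a r₁ r₂} → c₁ ≤ 1 + a * r₁ → c₂ ≤ 1 + a * r₂ → 1 ≤ r₁ + r₂ →
                 c₁ + c₂ ≤ (2 + a) * (r₁ + r₂)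
splitting-cost {c₁} {c₂} {a} {r₁} {r₂} h₁ h₂ r≥1 = begin
  c₁ + c₂                     ≤⟨ +-mono-≤ h₁ h₂ ⟩
  (1 + a * r₁) + (1 + a * r₂) ≡⟨ regroup a r₁ r₂ ⟩
  2 * 1 + a * (r₁ + r₂)       ≤⟨ +-monoˡ-≤ (a * (r₁ + r₂)) (*-monoʳ-≤ 2 r≥1) ⟩
  2 * (r₁ + r₂) + a * (r₁ + r₂) ≡⟨ *-distribʳ-+ (r₁ + r₂) 2 a ⟨
  (2 + a) * (r₁ + r₂)         ∎
  where
  open ≤-Reasoning
  regroup : ∀ a r₁ r₂ → (1 + a * r₁) + (1 + a * r₂) ≡ 2 * 1 + a * (r₁ + r₂)
  regroup = solve-∀

module GroupTesting {A : Set} (i : Fin k) (test : List A → Subset n) where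

  search : ℕ → List A → Query n k (List A)
  search zero    W = ask i (test W) λ b → ret (if b then W else [])
  search (suc h) W = ask i (test W) λ where
    false → ret []
    true  → search h (take (2 ^ h) W) >>= λ xs → search h (drop (2 ^ h) W) >>= λ ys → ret (xs ++ ys)

  module Spec (M : Fin k → Indep n) (good : A → Bool)
           (test⇒good : ∀ W → M i (test W) ≡ true → Any (λ u → good u ≡ true) W)
           (good⇒test : ∀ {W u} → u ∈ˡ W → good u ≡ true → M i (test W) ≡ true) where

    private
      halves : Query n k (List A) → Query n k (List A) → Query n k (List A)
      halves q₁ q₂ = q₁ >>= λ xs → q₂ >>= λ ys → ret (xs ++ ys)

      run-halves : ∀ q₁ q₂ → run M (halves q₁ q₂) ≡ run M q₁ ++ run M q₂
      run-halves q₁ q₂ rewrite run->>= M q₁ (λ xs → q₂ >>= λ ys → ret (xs ++ ys))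
                             | run->>= M q₂ (λ ys → ret (run M q₁ ++ ys)) = refl

      cost-halves : ∀ q₁ q₂ → cost M (halves q₁ q₂) ≡ cost M q₁ + cost M q₂
      cost-halves q₁ q₂ rewrite cost->>= M q₁ (λ xs → q₂ >>= λ ys → ret (xs ++ ys))
                              | cost->>= M q₂ (λ ys → ret (run M q₁ ++ ys))
                              | +-identityʳ (cost M q₂) = refl

      halves-bounded : ∀ h (W : List A) → length W ≤ 2 ^ suc h →
                       length (take (2 ^ h) W) ≤ 2 ^ h × length (drop (2 ^ h) W) ≤ 2 ^ h
      halves-bounded h W len = length-take-drop≤ (2 ^ h) W (subst (length W ≤_) (2^suc≡2^+2^ h) len)

      filterᵇ-take-drop : ∀ m W → filterᵇ good W ≡ filterᵇ good (take m W) ++ filterᵇ good (drop m W)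
      filterᵇ-take-drop m W = trans (cong (filterᵇ good) (sym (take++drop≡id m W)))
                                    (filter-++ (T? ∘ good) (take m W) (drop m W))

    search-run : ∀ h W → length W ≤ 2 ^ h → run M (search h W) ≡ filterᵇ good W
    search-run zero [] _ with M i (test [])
    ... | true  = refl
    ... | false = refl
    search-run zero (u ∷ []) _ with M i (test (u ∷ [])) in t | good u in g
    ... | true  | true  = refl
    ... | false | false = refl
    ... | true  | false with test⇒good (u ∷ []) t
    ...   | here g′ = contradiction (trans (sym g′) g) λ ()
    search-run zero (u ∷ []) _ | false | true = contradiction (trans (sym (good⇒test (here refl) g)) t) λ ()
    search-run zero (_ ∷ _ ∷ _) (s≤s ())
    search-run (suc h) W len with M i (test W) in t
    ... | false = sym (filter-none (T? ∘ good) (All.tabulate λ u∈W gu →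
                    contradiction (trans (sym (good⇒test u∈W (T⇒≡true gu))) t) λ ()))
    ... | true  = begin
      run M (halves (search h (take (2 ^ h) W)) (search h (drop (2 ^ h) W)))
        ≡⟨ run-halves (search h (take (2 ^ h) W)) (search h (drop (2 ^ h) W)) ⟩
      run M (search h (take (2 ^ h) W)) ++ run M (search h (drop (2 ^ h) W))
        ≡⟨ cong₂ _++_ (search-run h (take (2 ^ h) W) (proj₁ bounds)) (search-run h (drop (2 ^ h) W) (proj₂ bounds)) ⟩
      filterᵇ good (take (2 ^ h) W) ++ filterᵇ good (drop (2 ^ h) W)
        ≡⟨ filterᵇ-take-drop (2 ^ h) W ⟨
      filterᵇ good W ∎
      where
      open ≡-Reasoning
      bounds = halves-bounded h W len

    -- W is split only after a positive test, i.e. when it contains a good element; that element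
    -- pays for the two extra queries of the split.
    search-cost : ∀ h W → length W ≤ 2 ^ h → cost M (search h W) ≤ 1 + 2 * h * length (filterᵇ good W)
    search-cost zero    W _ = s≤s z≤n
    search-cost (suc h) W len with M i (test W) in t
    ... | false = s≤s z≤n
    ... | true  = s≤s $ begin
      cost M (halves (search h (take (2 ^ h) W)) (search h (drop (2 ^ h) W)))
        ≡⟨ cost-halves (search h (take (2 ^ h) W)) (search h (drop (2 ^ h) W)) ⟩
      cost M (search h (take (2 ^ h) W)) + cost M (search h (drop (2 ^ h) W))
        ≤⟨ splitting-cost {a = 2 * h} {r₁ = length (filterᵇ good (take (2 ^ h) W))}
                          (search-cost h (take (2 ^ h) W) (proj₁ bounds))
                          (search-cost h (drop (2 ^ h) W) (proj₂ bounds))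
                          (subst (1 ≤_) found≡ (filter-some (T? ∘ good) (Any.map ≡true⇒T (test⇒good W t)))) ⟩
      (2 + 2 * h) * (length (filterᵇ good (take (2 ^ h) W)) + length (filterᵇ good (drop (2 ^ h) W)))
        ≡⟨ cong₂ _*_ (*-suc 2 h) found≡ ⟨
      2 * suc h * length (filterᵇ good W) ∎
      where
      open ≤-Reasoning
      bounds = halves-bounded h W len
      found≡ : length (filterᵇ good W) ≡
               length (filterᵇ good (take (2 ^ h) W)) + length (filterᵇ good (drop (2 ^ h) W))
      found≡ = trans (cong length (filterᵇ-take-drop (2 ^ h) W)) (length-++ (filterᵇ good (take (2 ^ h) W)))

Labelling : ℕ → Set
Labelling n = Fin n → Maybe ℕ

_⊑_ : Labelling n → Labelling n → Set
D ⊑ D′ = ∀ {x a} → D x ≡ just a → D′ x ≡ just a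

⊑-trans : ∀ {D₁ D₂ D₃ : Labelling n} → D₁ ⊑ D₂ → D₂ ⊑ D₃ → D₁ ⊑ D₃
⊑-trans D₁⊑D₂ D₂⊑D₃ = D₂⊑D₃ ∘ D₁⊑D₂

unlabelled : Labelling n → Subset n
unlabelled D = Vec.tabulate (is-nothing ∘ D)

∈-unlabelled⁺ : ∀ {D : Labelling n} {x} → D x ≡ nothing → x ∈ unlabelled D
∈-unlabelled⁺ Dx≡nothing = ∈-tabulate⁺ (cong is-nothing Dx≡nothing)

∈-unlabelled⁻ : ∀ {D : Labelling n} {x} → x ∈ unlabelled D → D x ≡ nothing
∈-unlabelled⁻ = is-nothing⇒≡nothing ∘ ∈-tabulate⁻

⊑⇒unlabelled⊇ : ∀ {D D′ : Labelling n} → D ⊑ D′ → unlabelled D′ ⊆ unlabelled D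
⊑⇒unlabelled⊇ {D = D} {D′} D⊑D′ {x} x∈ with D x in Dx
... | nothing = ∈-unlabelled⁺ Dx
... | just a  = contradiction (trans (sym (D⊑D′ Dx)) (∈-unlabelled⁻ x∈)) λ ()

_∈ˡ?_ : (x : Fin n) (xs : List (Fin n)) → Dec (x ∈ˡ xs)
x ∈ˡ? xs = Any.any? (x Fin.≟_) xs

labelAll : List (Fin n) → ℕ → Labelling n → Labelling n
labelAll us a D x with x ∈ˡ? us
... | yes _ = just a
... | no  _ = D x

module LabelAll {us : List (Fin n)} {a : ℕ} {D : Labelling n} where

  labelAll-∈ : ∀ {x} → x ∈ˡ us → labelAll us a D x ≡ just a
  labelAll-∈ {x} x∈us with x ∈ˡ? us
  ... | yes _   = refl
  ... | no  x∉us = contradiction x∈us x∉us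

  labelAll-just : ∀ {x b} → labelAll us a D x ≡ just b → (x ∈ˡ us × b ≡ a) ⊎ D x ≡ just b
  labelAll-just {x} eq with x ∈ˡ? us
  labelAll-just refl | yes x∈us = inj₁ (x∈us , refl)
  labelAll-just eq   | no  _    = inj₂ eq

  module _ (new : All (λ u → D u ≡ nothing) us) where

    ⊑-labelAll : D ⊑ labelAll us a D
    ⊑-labelAll {x} Dx with x ∈ˡ? us
    ... | yes x∈us = contradiction (trans (sym Dx) (All.lookup new x∈us)) λ ()
    ... | no  _    = Dx

    labelAll-count : Unique us → length us + ∣ unlabelled (labelAll us a D) ∣ ≤ ∣ unlabelled D ∣
    labelAll-count unique = length+∣q∣≤∣p∣ unique (All.map ∈-unlabelled⁺ new)
      (All.tabulate λ u∈us u∈ → contradiction (trans (sym (labelAll-∈ u∈us)) (∈-unlabelled⁻ u∈)) λ ())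
      (⊑⇒unlabelled⊇ ⊑-labelAll)

open LabelAll public

record DistanceCertificate (M : Fin k → Indep n) (f : Assignment n k) (ℓ : Vtx n k → Maybe ℕ) : Set where
  field
    source   : ℓ src ≡ just 0
    realised : ∀ {v a} → ℓ v ≡ just a → WalkFromS M f v a
    closed   : ∀ {u v a} → Edge M f u v → ℓ u ≡ just a → ∃[ b ] (ℓ v ≡ just b × b ≤ suc a)

  walk-bounds : ∀ {v d} → WalkFromS M f v d → ∃[ b ] (ℓ v ≡ just b × b ≤ d)
  walk-bounds here = 0 , source , z≤n
  walk-bounds (step w e) with walk-bounds w
  ... | a , ℓu , a≤d with closed e ℓu
  ...   | b , ℓv , b≤ = b , ℓv , ≤-trans b≤ (s≤s a≤d)

  isDist : ∀ v → IsDist M f v (ℓ v)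
  isDist v with ℓ v in ℓv
  ... | just a  = realised ℓv , λ d w → let b , ℓv′ , b≤d = walk-bounds w in
                                        subst (_≤ d) (just-injective (trans (sym ℓv′) ℓv)) b≤d
  ... | nothing = λ d w → let _ , ℓv′ , _ = walk-bounds w in contradiction (trans (sym ℓv′) ℓv) λ ()

module Algorithm {n k : ℕ} (f : Assignment n k) where

  members : Fin k → List (Fin n)
  members i = filterᵇ (λ u → inBlock i (f u)) (allFin n)

  uncovered : List (Fin n)
  uncovered = filterᵇ (is-nothing ∘ f) (allFin n)

  initial : Labelling n
  initial = labelAll uncovered 1 (λ _ → nothing)

  depth : ℕ
  depth = suc ⌊log₂ ∣ covered f ∣ ⌋

  Table : Set
  Table = Fin k → Fin n → Bool

  table : Query n k Table
  table = tabulateQ λ i → tabulateQ λ x → ask i (block f i ∪ ⁅ x ⁆) ret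

  exchangeTest : Fin k → Fin n → List (Fin n) → Subset n
  exchangeTest i v W = (block f i ∪ ⁅ v ⁆) ─ fromList W

  Frontier : Set
  Frontier = Labelling n × List (Fin n)

  unlabelledMembers : Labelling n → Fin k → List (Fin n)
  unlabelledMembers D i = filterᵇ (is-nothing ∘ D) (members i)

  module _ (t : Table) where

    newNeighbours : Fin n → Fin k → Labelling n → Query n k (List (Fin n))
    newNeighbours v i D =
      if t i v then ret [] else GroupTesting.search i (exchangeTest i v) depth (unlabelledMembers D i)

    visitVia : ℕ → Fin n → Fin k → Frontier → Query n k Frontier
    visitVia a v i (D , N) = newNeighbours v i D >>= λ ys → ret (labelAll ys a D , N ++ ys)

    visit : ℕ → Fin n → Frontier → Query n k Frontier
    visit a v = foldQ (visitVia a v) (allFin k)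

    expandLayer : ℕ → List (Fin n) → Frontier → Query n k Frontier
    expandLayer a = foldQ (visit a)

    -- The fuel n is never exhausted: expanding a nonempty layer L decreases length L + ∣ unlabelled D ∣.
    bfs : ℕ → ℕ → List (Fin n) → Labelling n → Query n k (Labelling n)
    bfs zero       d L       D = ret D
    bfs (suc fuel) d []      D = ret D
    bfs (suc fuel) d (v ∷ L) D =
      expandLayer (suc d) (v ∷ L) (D , []) >>= λ σ → bfs fuel (suc d) (proj₂ σ) (proj₁ σ)

    exitLabel : Labelling n → Fin k → Fin n → Maybe ℕ
    exitLabel D i x = if t i x ∧ not (inBlock i (f x)) then Maybe.map suc (D x) else nothing

    distances : Labelling n → Vtx n k → Maybe ℕ
    distances D (vx x)  = D x
    distances D src     = just 0
    distances D (tgt i) = minimumᴹ (mapMaybe (exitLabel D i) (allFin n))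

  algorithm : Query n k (Vtx n k → Maybe ℕ)
  algorithm = table >>= λ t → bfs t n 1 uncovered initial >>= λ D → ret (distances t D)

-- Correctness and query count
module Specification {n k : ℕ} (M : Fin k → Indep n) (matroids : ∀ i → IsMatroid (M i))
                     (f : Assignment n k) (valid : ValidPartition M f) where
  open Algorithm f

  t : Table
  t = run M table

  t≡M : ∀ i x → t i x ≡ M i (block f i ∪ ⁅ x ⁆)
  t≡M i x = trans (cong-app (run-tabulateQ M _ i) x) (run-tabulateQ M (λ x → ask i (block f i ∪ ⁅ x ⁆) ret) x)

  ∈-members⁺ : ∀ {i u} → u ∈ block f i → u ∈ˡ members i
  ∈-members⁺ {i} {u} u∈ = ∈-filterᵇ⁺ {p = λ u → inBlock i (f u)} (∈ˡ.∈-allFin u) (∈-tabulate⁻ u∈)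

  ∈-members⁻ : ∀ {i u} → u ∈ˡ members i → u ∈ block f i
  ∈-members⁻ {i} = ∈-tabulate⁺ ∘ proj₂ ∘ ∈-filterᵇ⁻ (λ u → inBlock i (f u)) (allFin n)

  unlabelledMembers-unique : ∀ D i → Unique (unlabelledMembers D i)
  unlabelledMembers-unique D i = Unique.filter⁺ _ (Unique.filter⁺ _ (Unique.allFin⁺ n))

  block⊆covered : ∀ {i} → block f i ⊆ covered f
  block⊆covered {i} {x} x∈ = ∈-tabulate⁺ (inBlock⇒isJust (f x) (∈-tabulate⁻ x∈))
    where
    inBlock⇒isJust : ∀ m → inBlock i m ≡ true → isJust m ≡ true
    inBlock⇒isJust (just _) _ = refl

  length-unlabelledMembers : ∀ D i → length (unlabelledMembers D i) ≤ 2 ^ depth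
  length-unlabelledMembers D i = <⇒≤ $ ≤-<-trans
    (length≤∣p∣ (unlabelledMembers-unique D i)
                (All.tabulate (block⊆covered ∘ ∈-members⁻ ∘ proj₁ ∘ ∈-filterᵇ⁻ (is-nothing ∘ D) (members i))))
    (n<2^suc⌊log₂n⌋ ∣ covered f ∣)

  module Exchange (v : Fin n) (i : Fin k) where

    S+v : Subset n
    S+v = block f i ∪ ⁅ v ⁆

    exchangeable : Fin n → Bool
    exchangeable u = M i (S+v - u)

    found : Labelling n → List (Fin n)
    found D = if t i v then [] else filterᵇ exchangeable (unlabelledMembers D i)

    module _ (dep : M i S+v ≡ false) where
      open IsMatroid (matroids i)

      v∉block : v ∉ block f i
      v∉block v∈ = contradiction (trans (sym (down-closed _ S+v (∪⁅⁆⊆ id v∈) (valid i))) dep) λ ()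

      test⇒exchangeable : ∀ W → M i (exchangeTest i v W) ≡ true → Any (λ u → exchangeable u ≡ true) W
      test⇒exchangeable W indep with independent-removal (matroids i) (valid i) v∉block dep (fromList W) indep
      ... | u , u∈W , indep-u = Any.map (λ { refl → indep-u }) (∈-fromList⁻ W u∈W)

      exchangeable⇒test : ∀ {W u} → u ∈ˡ W → exchangeable u ≡ true → M i (exchangeTest i v W) ≡ true
      exchangeable⇒test {W} u∈W = down-closed _ _ (p─q⊆p-x S+v (fromList W) (∈-fromList⁺ u∈W))

      open GroupTesting i (exchangeTest i v)
      open Spec M exchangeable test⇒exchangeable exchangeable⇒test public

    run-newNeighbours : ∀ D → run M (newNeighbours t v i D) ≡ found D
    run-newNeighbours D with t i v in tiv
    ... | true  = refl
    ... | false = search-run (trans (sym (t≡M i v)) tiv) depth _ (length-unlabelledMembers D i)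

    cost-newNeighbours : ∀ D → cost M (newNeighbours t v i D) ≤ 1 + 2 * depth * length (found D)
    cost-newNeighbours D with t i v in tiv
    ... | true  = z≤n
    ... | false = search-cost (trans (sym (t≡M i v)) tiv) depth _ (length-unlabelledMembers D i)

    found-unique : ∀ D → Unique (found D)
    found-unique D with t i v
    ... | true  = AllPairs.[]
    ... | false = Unique.filter⁺ _ (unlabelledMembers-unique D i)

    ∈-found⁻ : ∀ {D y} → y ∈ˡ found D → D y ≡ nothing × Edge M f (vx v) (vx y)
    ∈-found⁻ {D} {y} y∈ with t i v in tiv
    ∈-found⁻ () | true
    ... | false with ∈-filterᵇ⁻ exchangeable _ y∈
    ...   | y∈W , exchangeable-y with ∈-filterᵇ⁻ (is-nothing ∘ D) (members i) y∈W
    ...     | y∈members , unlabelled-y =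
      is-nothing⇒≡nothing unlabelled-y ,
      exch v y i (∈-members⁻ y∈members) (trans (sym (t≡M i v)) tiv) exchangeable-y

    found-unlabelled : ∀ D → All (λ y → D y ≡ nothing) (found D)
    found-unlabelled D = All.tabulate (proj₁ ∘ ∈-found⁻)

    ∈-found⁺ : ∀ {D y} → y ∈ block f i → M i S+v ≡ false → exchangeable y ≡ true → D y ≡ nothing →
               y ∈ˡ found D
    ∈-found⁺ y∈ dep exchangeable-y Dy with t i v in tiv
    ... | true  = contradiction (trans (sym tiv) (trans (t≡M i v) dep)) λ ()
    ... | false = ∈-filterᵇ⁺ (∈-filterᵇ⁺ (∈-members⁺ y∈) (cong is-nothing Dy)) exchangeable-y

  open Exchange using (found; ∈-found⁺; found-unique; found-unlabelled; run-newNeighbours; cost-newNeighbours)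

  Walk : Vtx n k → ℕ → Set
  Walk = WalkFromS M f

  Closed : Labelling n → Fin n → ℕ → Set
  Closed D x a = ∀ {y} → Edge M f (vx x) (vx y) → ∃[ b ] (D y ≡ just b × b ≤ suc a)

  ExploredVia : Labelling n → Fin n → Fin k → Set
  ExploredVia D v i = ∀ {y} → y ∈ block f i → M i (block f i ∪ ⁅ v ⁆) ≡ false →
                      M i ((block f i ∪ ⁅ v ⁆) - y) ≡ true → ∃[ b ] (D y ≡ just b)

  closed-⊑ : ∀ {D D′ x a} → D ⊑ D′ → Closed D x a → Closed D′ x a
  closed-⊑ D⊑D′ closed e with closed e
  ... | b , Dy , b≤ = b , D⊑D′ Dy , b≤

  explored-⊑ : ∀ {D D′ v i} → D ⊑ D′ → ExploredVia D v i → ExploredVia D′ v i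
  explored-⊑ D⊑D′ explored y∈ dep e with explored y∈ dep e
  ... | b , Dy = b , D⊑D′ Dy

  record Layered (d : ℕ) (L N : List (Fin n)) (D : Labelling n) : Set where
    field
      realised : ∀ {x a} → D x ≡ just a → Walk (vx x) a
      bounded  : ∀ {x a} → D x ≡ just a → a ≤ suc d
      current  : ∀ {x} → x ∈ˡ L → D x ≡ just d
      next     : ∀ {x} → x ∈ˡ N → D x ≡ just (suc d)
      settled  : ∀ {x a} → D x ≡ just a → x ∈ˡ L ⊎ x ∈ˡ N ⊎ Closed D x a

  LayeredAt : ℕ → List (Fin n) → Frontier → Set
  LayeredAt d L (D , N) = Layered d L N D

  unlabelledCount : Frontier → ℕ
  unlabelledCount (D , N) = ∣ unlabelled D ∣

  pending : Frontier → ℕ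
  pending (D , N) = length N + ∣ unlabelled D ∣

  run-visitVia : ∀ a v i D N →
                 run M (visitVia t a v i (D , N)) ≡ (labelAll (found v i D) a D , N ++ found v i D)
  run-visitVia a v i D N = trans (run->>= M (newNeighbours t v i D) _)
                                 (cong (λ ys → labelAll ys a D , N ++ ys) (run-newNeighbours v i D))

  module _ (a : ℕ) (v : Fin n) (i : Fin k) (D : Labelling n) where
    private
      ys = found v i D

    ⊑-labelFound : D ⊑ labelAll ys a D
    ⊑-labelFound = ⊑-labelAll {a = a} (found-unlabelled v i D)

    labelFound-explored : ExploredVia (labelAll ys a D) v i
    labelFound-explored {y} y∈ dep exchangeable-y with D y in Dy
    ... | just b  = b , ⊑-labelFound Dy
    ... | nothing = a , labelAll-∈ (∈-found⁺ v i y∈ dep exchangeable-y Dy)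

    labelFound-pending : ∀ N → pending (labelAll ys a D , N ++ ys) ≤ pending (D , N)
    labelFound-pending N = begin
      length (N ++ ys) + ∣ unlabelled (labelAll ys a D) ∣   ≡⟨ cong (_+ _) (length-++ N) ⟩
      length N + length ys + ∣ unlabelled (labelAll ys a D) ∣ ≡⟨ +-assoc (length N) _ _ ⟩
      length N + (length ys + ∣ unlabelled (labelAll ys a D) ∣)
        ≤⟨ +-monoʳ-≤ (length N) (labelAll-count (found-unlabelled v i D) (found-unique v i D)) ⟩
      length N + ∣ unlabelled D ∣                           ∎
      where open ≤-Reasoning

    visitVia-cost : ∀ N → cost M (visitVia t a v i (D , N)) + 2 * depth * ∣ unlabelled (labelAll ys a D) ∣ ≤
                          1 + 2 * depth * ∣ unlabelled D ∣
    visitVia-cost N = begin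
      cost M (visitVia t a v i (D , N)) + w * ∣ unlabelled (labelAll ys a D) ∣
        ≡⟨ cong (_+ _) (trans (cost->>= M (newNeighbours t v i D) _) (+-identityʳ _)) ⟩
      cost M (newNeighbours t v i D) + w * ∣ unlabelled (labelAll ys a D) ∣
        ≤⟨ +-monoˡ-≤ _ (cost-newNeighbours v i D) ⟩
      1 + w * length ys + w * ∣ unlabelled (labelAll ys a D) ∣
        ≡⟨ cong suc (*-distribˡ-+ w (length ys) ∣ unlabelled (labelAll ys a D) ∣) ⟨
      1 + w * (length ys + ∣ unlabelled (labelAll ys a D) ∣)
        ≤⟨ +-monoʳ-≤ 1 (*-monoʳ-≤ w (labelAll-count (found-unlabelled v i D) (found-unique v i D))) ⟩
      1 + w * ∣ unlabelled D ∣ ∎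
      where
      open ≤-Reasoning
      w = 2 * depth

  module _ {d : ℕ} {v : Fin n} {L : List (Fin n)} where

    labelFound-layered : ∀ {i D N} → Layered d (v ∷ L) N D →
                         Layered d (v ∷ L) (N ++ found v i D) (labelAll (found v i D) (suc d) D)
    labelFound-layered {i} {D} {N} layered = record
      { realised = λ Dx → [ (λ { (x∈ys , refl) → step (realised (current (here refl))) (proj₂ (∈-found⁻ x∈ys)) })
                          , realised ]′ (ℓ.labelAll-just Dx)
      ; bounded  = λ Dx → [ (λ { (_ , refl) → ≤-refl }) , bounded ]′ (ℓ.labelAll-just Dx)
      ; current  = ⊑ ∘ current
      ; next     = λ x∈ → [ ⊑ ∘ next , ℓ.labelAll-∈ ]′ (∈-++⁻ N x∈)
      ; settled  = λ Dx → [ (λ (x∈ys , _) → inj₂ (inj₁ (∈-++⁺ʳ N x∈ys)))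
                          , (λ Dx → Sum.map₂ (Sum.map (∈-++⁺ˡ) (closed-⊑ ⊑)) (settled Dx)) ]′ (ℓ.labelAll-just Dx)
      }
      where
      open Layered layered
      open Exchange v i using (∈-found⁻)
      module ℓ = LabelAll {us = found v i D} {a = suc d} {D = D}
      ⊑ = ⊑-labelFound (suc d) v i D

    close-current : ∀ {D N} → Layered d (v ∷ L) N D → (∀ j → ExploredVia D v j) → Layered d L N D
    close-current {D} {N} layered explored = record
      { realised = realised
      ; bounded  = bounded
      ; current  = current ∘ there
      ; next     = next
      ; settled  = λ {x} Dx → [ (λ { (here refl) → inj₂ (inj₂ (closed-v Dx)) ; (there x∈L) → inj₁ x∈L })
                            , inj₂ ]′ (settled Dx)
      }
      where
      open Layered layered
      closed-v : ∀ {a} → D v ≡ just a → Closed D v a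
      closed-v Dv (exch _ _ j y∈ dep e) with explored j y∈ dep e
      ... | b , Dy = b , Dy , subst (λ c → b ≤ suc c) (just-injective (trans (sym (current (here refl))) Dv))
                                    (bounded Dy)

  Φ : Frontier → ℕ
  Φ σ = 2 * depth * unlabelledCount σ

  module _ (a : ℕ) (v : Fin n) where

    visitVia-⊑ : ∀ i σ → proj₁ σ ⊑ proj₁ (run M (visitVia t a v i σ))
    visitVia-⊑ i (D , N) rewrite run-visitVia a v i D N = ⊑-labelFound a v i D

    visitVia-pending : ∀ i σ → pending (run M (visitVia t a v i σ)) ≤ pending σ
    visitVia-pending i (D , N) rewrite run-visitVia a v i D N = labelFound-pending a v i D N

    visitVia-amortised : ∀ i σ → cost M (visitVia t a v i σ) + Φ (run M (visitVia t a v i σ)) ≤ 1 + Φ σ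
    visitVia-amortised i (D , N) rewrite run-visitVia a v i D N = visitVia-cost a v i D N

    visit-⊑ : ∀ σ → proj₁ σ ⊑ proj₁ (run M (visit t a v σ))
    visit-⊑ = foldQ-monotone M (visitVia t a v) (λ σ σ′ → proj₁ σ ⊑ proj₁ σ′) id ⊑-trans visitVia-⊑ (allFin k)

    visit-pending : ∀ σ → pending (run M (visit t a v σ)) ≤ pending σ
    visit-pending = foldQ-monotone M (visitVia t a v) (λ σ σ′ → pending σ′ ≤ pending σ) ≤-refl (flip ≤-trans)
                      visitVia-pending (allFin k)

    visit-amortised : ∀ σ → cost M (visit t a v σ) + Φ (run M (visit t a v σ)) ≤ k + Φ σ
    visit-amortised σ = ≤-trans (foldQ-cost M (visitVia t a v) Φ 1 visitVia-amortised (allFin k) σ)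
                          (≤-reflexive (cong (_+ Φ σ) (trans (*-identityʳ _) (length-tabulate {n = k} id))))

  module _ (d : ℕ) (v : Fin n) (L : List (Fin n)) where

    Visiting : List (Fin k) → Frontier → Set
    Visiting is σ = LayeredAt d (v ∷ L) σ × (∀ j → j ∈ˡ is ⊎ ExploredVia (proj₁ σ) v j)

    visitVia-visiting : ∀ {i is σ} → Visiting (i ∷ is) σ → Visiting is (run M (visitVia t (suc d) v i σ))
    visitVia-visiting {i} {is} {D , N} (layered , explored) rewrite run-visitVia (suc d) v i D N =
      labelFound-layered layered , λ j → [ (λ { (here refl) → inj₂ (labelFound-explored (suc d) v i D)
                                              ; (there j∈is) → inj₁ j∈is })
                                         , inj₂ ∘ explored-⊑ (⊑-labelFound (suc d) v i D) ]′ (explored j)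

  visit-layered : ∀ {d v L} σ → LayeredAt d (v ∷ L) σ → LayeredAt d L (run M (visit t (suc d) v σ))
  visit-layered {d} {v} {L} σ layered
    with foldQ-invariant M (visitVia t (suc d) v) (Visiting d v L) (visitVia-visiting d v L) (allFin k)
                         (layered , λ j → inj₁ (∈ˡ.∈-allFin j))
  ... | layered′ , explored = close-current layered′ λ j → [ (λ ()) , id ]′ (explored j)

  module _ (a : ℕ) where

    expandLayer-⊑ : ∀ L σ → proj₁ σ ⊑ proj₁ (run M (expandLayer t a L σ))
    expandLayer-⊑ = foldQ-monotone M (visit t a) (λ σ σ′ → proj₁ σ ⊑ proj₁ σ′) id ⊑-trans (λ v → visit-⊑ a v)

    expandLayer-pending : ∀ L σ → pending (run M (expandLayer t a L σ)) ≤ pending σ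
    expandLayer-pending = foldQ-monotone M (visit t a) (λ σ σ′ → pending σ′ ≤ pending σ) ≤-refl (flip ≤-trans)
                            (λ v → visit-pending a v)

    expandLayer-amortised : ∀ L σ → cost M (expandLayer t a L σ) + Φ (run M (expandLayer t a L σ)) ≤
                                    length L * k + Φ σ
    expandLayer-amortised = foldQ-cost M (visit t a) Φ k (λ v → visit-amortised a v)

  expandLayer-layered : ∀ {d} L σ → LayeredAt d L σ → LayeredAt d [] (run M (expandLayer t (suc d) L σ))
  expandLayer-layered {d} L σ = foldQ-invariant M (visit t (suc d)) (LayeredAt d) (λ {_} {_} {σ} → visit-layered σ) L

  advance : ∀ {d N D} → Layered d [] N D → Layered (suc d) N [] D
  advance layered = record
    { realised = realised
    ; bounded  = m≤n⇒m≤1+n ∘ bounded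
    ; current  = next
    ; next     = λ ()
    ; settled  = λ Dx → [ (λ ()) , [ inj₁ , inj₂ ∘ inj₂ ]′ ]′ (settled Dx)
    }
    where open Layered layered

  record Settled (D : Labelling n) : Set where
    field
      realised : ∀ {x a} → D x ≡ just a → Walk (vx x) a
      closed   : ∀ {x a} → D x ≡ just a → Closed D x a

  exhausted : ∀ {d D} → Layered d [] [] D → Settled D
  exhausted layered = record
    { realised = realised
    ; closed   = λ Dx → [ (λ ()) , [ (λ ()) , id ]′ ]′ (settled Dx)
    }
    where open Layered layered

  expandLayer-shrinks : ∀ {fuel} d v L D → length (v ∷ L) + ∣ unlabelled D ∣ ≤ suc fuel →
                        pending (run M (expandLayer t (suc d) (v ∷ L) (D , []))) ≤ fuel
  expandLayer-shrinks d v L D bound = ≤-trans (expandLayer-pending (suc d) (v ∷ L) (D , []))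
                                              (≤-trans (m≤n+m _ (length L)) (≤-pred bound))

  bfs-settles : ∀ fuel d L D → Layered d L [] D → length L + ∣ unlabelled D ∣ ≤ fuel →
                D ⊑ run M (bfs t fuel d L D) × Settled (run M (bfs t fuel d L D))
  bfs-settles zero       d []      D layered _ = id , exhausted layered
  bfs-settles (suc fuel) d []      D layered _ = id , exhausted layered
  bfs-settles (suc fuel) d (v ∷ L) D layered bound =
    subst (λ D′ → D ⊑ D′ × Settled D′) (sym (run->>= M layer λ σ → bfs t fuel (suc d) (proj₂ σ) (proj₁ σ)))
          (⊑-trans {D₂ = proj₁ σ} (expandLayer-⊑ (suc d) (v ∷ L) (D , [])) (proj₁ rest) , proj₂ rest)
    where
    layer = expandLayer t (suc d) (v ∷ L) (D , [])
    σ = run M layer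
    rest = bfs-settles fuel (suc d) (proj₂ σ) (proj₁ σ) (advance (expandLayer-layered (v ∷ L) (D , []) layered))
             (expandLayer-shrinks d v L D bound)

  bfs-cost : ∀ fuel d L D → length L + ∣ unlabelled D ∣ ≤ fuel →
             cost M (bfs t fuel d L D) ≤ k * (length L + ∣ unlabelled D ∣) + 2 * depth * ∣ unlabelled D ∣
  bfs-cost zero       d []      D _ = z≤n
  bfs-cost (suc fuel) d []      D _ = z≤n
  bfs-cost (suc fuel) d (v ∷ L) D bound = begin
    cost M (layer >>= λ σ → bfs t fuel (suc d) (proj₂ σ) (proj₁ σ))
      ≡⟨ cost->>= M layer (λ σ → bfs t fuel (suc d) (proj₂ σ) (proj₁ σ)) ⟩
    cost M layer + cost M (bfs t fuel (suc d) (proj₂ σ) (proj₁ σ))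
      ≤⟨ combine {w = 2 * depth} {u₁ = ∣ unlabelled (proj₁ σ) ∣} {m = length (proj₂ σ)}
                 (expandLayer-amortised (suc d) (v ∷ L) (D , []))
                 (bfs-cost fuel (suc d) (proj₂ σ) (proj₁ σ) (expandLayer-shrinks d v L D bound))
                 (expandLayer-pending (suc d) (v ∷ L) (D , [])) ⟩
    k * (length (v ∷ L) + ∣ unlabelled D ∣) + 2 * depth * ∣ unlabelled D ∣ ∎
    where
    open ≤-Reasoning
    layer = expandLayer t (suc d) (v ∷ L) (D , [])
    σ = run M layer
    combine : ∀ {x₁ x₂ w u₁ u ℓ m} → x₁ + w * u₁ ≤ ℓ * k + w * u → x₂ ≤ k * (m + u₁) + w * u₁ →
              m + u₁ ≤ u → x₁ + x₂ ≤ k * (ℓ + u) + w * u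
    combine {x₁} {x₂} {w} {u₁} {u} {ℓ} {m} h₁ h₂ h₃ = begin
      x₁ + x₂                                   ≤⟨ +-monoʳ-≤ x₁ h₂ ⟩
      x₁ + (k * (m + u₁) + w * u₁)              ≡⟨ swap x₁ (k * (m + u₁)) (w * u₁) ⟩
      (x₁ + w * u₁) + k * (m + u₁)              ≤⟨ +-mono-≤ h₁ (*-monoʳ-≤ k h₃) ⟩
      (ℓ * k + w * u) + k * u                   ≡⟨ regroup ℓ k w u ⟩
      k * (ℓ + u) + w * u                       ∎
      where
      swap : ∀ a b c → a + (b + c) ≡ (a + c) + b
      swap = solve-∀
      regroup : ∀ ℓ k w u → (ℓ * k + w * u) + k * u ≡ k * (ℓ + u) + w * u
      regroup = solve-∀

  ∈-uncovered⁺ : ∀ {x} → f x ≡ nothing → x ∈ˡ uncovered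
  ∈-uncovered⁺ {x} fx = ∈-filterᵇ⁺ (∈ˡ.∈-allFin x) (cong is-nothing fx)

  ∈-uncovered⁻ : ∀ {x} → x ∈ˡ uncovered → f x ≡ nothing
  ∈-uncovered⁻ = is-nothing⇒≡nothing ∘ proj₂ ∘ ∈-filterᵇ⁻ (is-nothing ∘ f) (allFin n)

  ∉covered⇒≡nothing : ∀ {x} → x ∉ covered f → f x ≡ nothing
  ∉covered⇒≡nothing {x} x∉ with f x in fx
  ... | nothing = refl
  ... | just _  = contradiction (∈-tabulate⁺ (cong isJust fx)) x∉

  ≡nothing⇒∉covered : ∀ {x} → f x ≡ nothing → x ∉ covered f
  ≡nothing⇒∉covered fx x∈ = contradiction (trans (sym (∈-tabulate⁻ x∈)) (cong isJust fx)) λ ()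

  private
    module Initial = LabelAll {us = uncovered} {a = 1} {D = λ _ → nothing}

  initial-layered : Layered 1 uncovered [] initial
  initial-layered = record
    { realised = λ Dx → [ (λ { (x∈ , refl) → step here (fromS _ (≡nothing⇒∉covered (∈-uncovered⁻ x∈))) })
                        , (λ ()) ]′ (Initial.labelAll-just Dx)
    ; bounded  = λ Dx → [ (λ { (_ , refl) → s≤s z≤n }) , (λ ()) ]′ (Initial.labelAll-just Dx)
    ; current  = Initial.labelAll-∈
    ; next     = λ ()
    ; settled  = λ Dx → [ inj₁ ∘ proj₁ , (λ ()) ]′ (Initial.labelAll-just Dx)
    }

  initial-pending : length uncovered + ∣ unlabelled initial ∣ ≤ n
  initial-pending = ≤-trans (Initial.labelAll-count (All.universal (λ _ → refl) uncovered)
                                                    (Unique.filter⁺ _ (Unique.allFin⁺ n)))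
                            (∣p∣≤n (unlabelled {n} (λ _ → nothing)))

  unlabelled-initial⊆covered : unlabelled initial ⊆ covered f
  unlabelled-initial⊆covered {x} x∈ with f x in fx
  ... | nothing = contradiction (trans (sym (Initial.labelAll-∈ (∈-uncovered⁺ fx))) (∈-unlabelled⁻ x∈)) λ ()
  ... | just _  = ∈-tabulate⁺ (cong isJust fx)

  module Output (D : Labelling n) (initial⊑D : initial ⊑ D) (settled : Settled D) where
    open Settled settled

    exitLabel-realised : ∀ i x → MaybeAll.All (Walk (tgt i)) (exitLabel t D i x)
    exitLabel-realised i x with t i x in tix | inBlock i (f x) in inB | D x in Dx
    ... | true  | false | just a  = MaybeAll.just (step (realised Dx) (toT x i x∉ (trans (sym (t≡M i x)) tix)))
      where
      x∉ : x ∉ block f i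
      x∉ x∈ = contradiction (trans (sym (∈-tabulate⁻ x∈)) inB) λ ()
    ... | true  | false | nothing = MaybeAll.nothing
    ... | true  | true  | _       = MaybeAll.nothing
    ... | false | _     | _       = MaybeAll.nothing

    exitLabel-toT : ∀ {i x a} → x ∉ block f i → M i (block f i ∪ ⁅ x ⁆) ≡ true → D x ≡ just a →
                    exitLabel t D i x ≡ just (suc a)
    exitLabel-toT {i} {x} x∉ indep Dx with inBlock i (f x) in inB
    ... | true  = contradiction (∈-tabulate⁺ inB) x∉
    ... | false rewrite t≡M i x | indep | Dx = refl

    certificate : DistanceCertificate M f (distances t D)
    certificate = record
      { source   = refl
      ; realised = λ { {vx x} → realised ; {src} refl → here ; {tgt i} →
                       minimumᴹ-just (Allₚ.mapMaybe⁺ (Allₚ.map⁺ (All.universal (exitLabel-realised i) (allFin n)))) }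
      ; closed   = λ { (exch _ _ _ y∈ dep e) Dx → closed Dx (exch _ _ _ y∈ dep e)
                     ; (fromS x x∉) refl →
                         1 , initial⊑D (Initial.labelAll-∈ (∈-uncovered⁺ (∉covered⇒≡nothing x∉))) , ≤-refl
                     ; (toT x i x∉ indep) Dx → minimumᴹ-≤ (Anyₚ.mapMaybe⁺ _ (allFin n) (Anyₚ.map⁺
                         (Any.map (λ { refl → subst (MaybeAny.Any (_≤ _)) (sym (exitLabel-toT x∉ indep Dx))
                                                     (MaybeAny.just ≤-refl) }) (∈ˡ.∈-allFin x)))) }
      }

  finalLabels : Labelling n
  finalLabels = run M (bfs t n 1 uncovered initial)

  run-algorithm : run M algorithm ≡ distances t finalLabels
  run-algorithm = trans (run->>= M table _) (run->>= M (bfs t n 1 uncovered initial) _)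

  algorithm-correct : ∀ v → IsDist M f v (run M algorithm v)
  algorithm-correct v with bfs-settles n 1 uncovered initial initial-layered initial-pending
  ... | initial⊑ , settled = subst (λ ℓ → IsDist M f v (ℓ v)) (sym run-algorithm)
                               (DistanceCertificate.isDist (Output.certificate finalLabels initial⊑ settled) v)

  algorithm-cost : cost M algorithm ≤ k * n + (k * n + 2 * depth * ∣ covered f ∣)
  algorithm-cost = begin
    cost M algorithm
      ≡⟨ cost->>= M table _ ⟩
    cost M table + cost M (bfs t n 1 uncovered initial >>= λ D → ret (distances t D))
      ≡⟨ cong (cost M table +_) (trans (cost->>= M (bfs t n 1 uncovered initial) _) (+-identityʳ _)) ⟩
    cost M table + cost M (bfs t n 1 uncovered initial)
      ≤⟨ +-mono-≤ (cost-tabulateQ M _ λ i → cost-tabulateQ M _ λ x → ≤-refl)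
                  (bfs-cost n 1 uncovered initial initial-pending) ⟩
    k * (n * 1) + (k * (length uncovered + u₀) + 2 * depth * u₀)
      ≤⟨ +-mono-≤ (≤-reflexive (cong (k *_) (*-identityʳ n)))
                  (+-mono-≤ (*-monoʳ-≤ k initial-pending)
                            (*-monoʳ-≤ (2 * depth) (p⊆q⇒∣p∣≤∣q∣ unlabelled-initial⊆covered))) ⟩
    k * n + (k * n + 2 * depth * ∣ covered f ∣) ∎
    where
    open ≤-Reasoning
    u₀ = ∣ unlabelled initial ∣

cost-bound : ∀ {kn s p} → s ≤ p → kn + (kn + 2 * suc ⌊log₂ s ⌋ * s) ≤ 4 * (kn + p * ⌊log₂ p ⌋) + 4
cost-bound {kn} {s} {p} s≤p = begin
  kn + (kn + 2 * suc ⌊log₂ s ⌋ * s)            ≡⟨ cong (λ x → kn + (kn + x)) (split ⌊log₂ s ⌋ s) ⟩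
  kn + (kn + (2 * s + 2 * (⌊log₂ s ⌋ * s)))
    ≤⟨ +-monoʳ-≤ kn (+-monoʳ-≤ kn (+-mono-≤ (*-monoʳ-≤ 2 s≤P+1) (*-monoʳ-≤ 2 Ls≤P))) ⟩
  kn + (kn + (2 * (P + 1) + 2 * P))           ≤⟨ m≤m+n _ (2 * kn + 2) ⟩
  kn + (kn + (2 * (P + 1) + 2 * P)) + (2 * kn + 2) ≡⟨ regroup kn P ⟩
  4 * (kn + P) + 4                             ∎
  where
  open ≤-Reasoning
  P = p * ⌊log₂ p ⌋
  s≤P+1 : s ≤ P + 1
  s≤P+1 = ≤-trans s≤p (n≤n*⌊log₂n⌋+1 p)
  Ls≤P : ⌊log₂ s ⌋ * s ≤ P
  Ls≤P = ≤-trans (*-mono-≤ (⌊log₂⌋-mono-≤ s≤p) s≤p) (≤-reflexive (*-comm ⌊log₂ p ⌋ p))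
  split : ∀ L s → 2 * suc L * s ≡ 2 * s + 2 * (L * s)
  split = solve-∀
  regroup : ∀ kn P → kn + (kn + (2 * (P + 1) + 2 * P)) + (2 * kn + 2) ≡ 4 * (kn + P) + 4
  regroup = solve-∀

lemma10 : Σ[ alg ∈ DistAlgorithm ] Σ[ c ∈ ℕ ]
            (∀ (n k : ℕ) (M : Fin k → Indep n) → (∀ i → IsMatroid (M i)) →
             ∀ (p : ℕ) → IsMaxPartitionable M p →
             ∀ (f : Assignment n k) → ValidPartition M f →
             (∀ (v : Vtx n k) → IsDist M f v (run M (alg n k f) v)) ×
             (cost M (alg n k f) ≤ c * (k * n + p * ⌊log₂ p ⌋) + c))
lemma10 = (λ n k f → Algorithm.algorithm f) , 4 , λ n k M matroids p (_ , maximal) f valid →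
  let open Specification M matroids f valid in
  algorithm-correct , ≤-trans algorithm-cost (cost-bound {kn = k * n} (maximal (covered f) (f , valid , refl)))
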